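{- Let $A[1,\dots,n]$ be an array over a totally ordered set with $A[t]\neq A[t+1]$ for all $t\in\{1,\dots,n-1\}$. For any node $i\in\{1,\dots,n-1\}$: if node $i$ is an internal node of $\mathsf{cMin}(A)$, then $f(i+1,\mathsf{cMin}(A))=f(i,\mathsf{cMin}(A))+1$ and $f(i+1,\mathsf{cMax}(A))=f(i,\mathsf{cMax}(A))+k$ for some $k>1$; otherwise $f(i+1,\mathsf{cMax}(A))=f(i,\mathsf{cMax}(A))+1$ and $f(i+1,\mathsf{cMin}(A))=f(i,\mathsf{cMin}(A))+k$ for some $k>1$.
   Context: $\mathsf{cMin}(A)$: rooted ordered tree on nodes $0,\dots,n$ (with $A[0]=-\infty$), root $0$, parent of node $i>0$ is the largest $j<i$ with $A[j]<A[i]$, children ordered by increasing index (node $i$ is the $(i+1)$-th node in preorder), with node colors. $\mathsf{cMax}(A)$: analogous with $A[0]=+\infty$ and parent of node $i>0$ the largest $j<i$ with $A[j]>A[i]$. For an ordered tree $T$, $\mathsf{BP}(T)$ is the bit string obtained by a preorder traversal writing $0$ when a node is first visited and $1$ after its subtree is finished; $f(i,T)$ is the position in $\mathsf{BP}(T)$ of the $0$ written for node $i$. -}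

module Defs where

open import Level using (Level)
open import Data.Nat using (ℕ; zero; suc; _+_; _∸_; _≤?_; _≟_)
open import Data.Fin using (Fin; fromℕ<)
open import Data.List using (List; []; _∷_; _++_; [_]; length; reverse; filter; upTo; map; concat)
open import Data.Bool using (Bool; true; false)
open import Data.Product using (_×_; _,_)
open import Relation.Nullary using (yes; no; Dec)
open import Relation.Nullary.Decidable using (⌊_⌋)
open import Relation.Binary.Bundles using (StrictTotalOrder)
open import Relation.Binary.PropositionalEquality using (_≡_)
open import Data.List.Membership.Propositional using (_∈_)

data Tree : Set where
  node : ℕ → List Tree → Tree

data Event : Set where
  open⟨_⟩ : ℕ → Event
  close   : Event

mutual
  events : Tree → List Event
  events (node i cs) = open⟨ i ⟩ ∷ (eventsF cs ++ [ close ])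

  eventsF : List Tree → List Event
  eventsF []       = []
  eventsF (t ∷ ts) = events t ++ eventsF ts

bit : Event → Bool
bit open⟨ _ ⟩ = false
bit close     = true

BP : Tree → List Bool
BP t = map bit (events t)

-- index (0-based) of the first occurrence of open⟨ i ⟩ in an event list
-- (returns the length of the list if it does not occur).
posOpen : ℕ → List Event → ℕ
posOpen i [] = 0
posOpen i (open⟨ j ⟩ ∷ es) with i ≟ j
... | yes _ = 0
... | no  _ = suc (posOpen i es)
posOpen i (close ∷ es) = suc (posOpen i es)

data Internal (i : ℕ) : Tree → Set where
  here  : ∀ c cs → Internal i (node i (c ∷ cs))
  there : ∀ {j cs t} → t ∈ cs → Internal i t → Internal i (node j cs)

-- f(i,T): position in BP(T) of the 0 written for node i (positions counted from 0).
f : ℕ → Tree → ℕ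
f i T = posOpen i (events T)

module Cartesian {c ℓ₁ ℓ₂ : Level} (O : StrictTotalOrder c ℓ₁ ℓ₂) where
  open StrictTotalOrder O using (_<?_) renaming (Carrier to C)

  -- extended values: A[0] = -∞ (for cMin) or +∞ (for cMax)
  data Ext : Set c where
    -∞ +∞ : Ext
    fin   : C → Ext

  _<ᴱ?_ : Ext → Ext → Bool
  -∞    <ᴱ? -∞    = false
  -∞    <ᴱ? _     = true
  +∞    <ᴱ? _     = false
  fin _ <ᴱ? -∞    = false
  fin _ <ᴱ? +∞    = true
  fin x <ᴱ? fin y = ⌊ x <? y ⌋

  module _ {n : ℕ} (A : Fin n → C) where

    -- A[j] for 1 ≤ j ≤ n (1-based array); A[0] = e0; out-of-range unused.
    val : Ext → ℕ → Ext
    val e0 zero = e0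
    val e0 (suc j) with suc j ≤? n
    ... | yes p = fin (A (fromℕ< p))
    ... | no  _ = e0

    -- largest j < i with A[j] ⋖ A[i] (j = 0 always qualifies since A[0] = ∓∞)
    search : (Ext → Ext → Bool) → Ext → ℕ → Ext → ℕ
    search R e0 zero    x = zero
    search R e0 (suc j) x with R (val e0 (suc j)) x
    ... | true  = suc j
    ... | false = search R e0 j x

    parent : (Ext → Ext → Bool) → Ext → ℕ → ℕ
    parent R e0 zero    = zero
    parent R e0 (suc i) = search R e0 i (val e0 (suc i))

    children : (Ext → Ext → Bool) → Ext → ℕ → List ℕ
    children R e0 j = filter (λ i → parent R e0 i ≟ j) (map suc (upTo n))

    -- build subtree rooted at j (fuel bounds depth; n+1 suffices)
    build : (Ext → Ext → Bool) → Ext → ℕ → ℕ → Tree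
    build R e0 zero    j = node j []
    build R e0 (suc k) j = node j (map (build R e0 k) (children R e0 j))

    cMin : Tree
    cMin = build (λ a b → a <ᴱ? b) -∞ (suc n) zero

    cMax : Tree
    cMax = build (λ a b → b <ᴱ? a) +∞ (suc n) zero

module Submission where

-- The preorder of either tree lists its nodes in index order: everything written before the 0 of
-- node x opens a smaller node (earlier siblings and their descendants are smaller than x, since
-- parent intervals are nested). So f(i+1) − f(i) − 1 counts the 1s between the 0s of i and i+1.
-- If A[i] and A[i+1] are ordered as the tree requires (A[i] < A[i+1] for cMin), then i is the
-- parent of i+1, which is its first child, and the gap is 1. Otherwise nestedness forbids any node
-- from having parent i, so i is a leaf and the 1 closing it falls in the gap. As A[i] ≠ A[i+1],
-- exactly one of cMin and cMax attaches i+1 to i, and it is cMin exactly when i is internal there.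

open import Level using (Level)
open import Function using (_∘_)
open import Data.Bool using (Bool; true; false; not)
open import Data.Bool.Properties using (¬-not)
open import Data.Nat using (ℕ; zero; suc; _+_; _<_; _≤_; z≤n; s≤s; _≟_; _≤?_)
open import Data.Nat.Properties
open import Data.Nat.Induction using (<-rec)
open import Data.Fin using (Fin; toℕ; fromℕ<)
open import Data.Fin.Properties using (toℕ-fromℕ<)
open import Data.Product using (_×_; ∃; ∃₂; _,_; proj₁; proj₂)
open import Data.Sum as Sum using (_⊎_; inj₁; inj₂; swap)
open import Data.List using (List; []; _∷_; _++_; [_]; length; map; upTo)
open import Data.List.Properties using (++-assoc; ++-identityʳ; map-++; filter-none)
open import Data.List.Relation.Unary.All as All using (All; []; _∷_)
open import Data.List.Relation.Unary.All.Properties using (++⁺)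
open import Data.List.Relation.Unary.AllPairs using (AllPairs; []; _∷_)
import Data.List.Relation.Unary.AllPairs.Properties as AllPairs
open import Data.List.Relation.Unary.Any using (here; there)
open import Data.List.Membership.Propositional using (_∈_)
open import Data.List.Membership.Propositional.Properties
  using (∈-map⁺; ∈-map⁻; ∈-++⁺ˡ; ∈-filter⁺; ∈-filter⁻; ∈-upTo⁺; ∈-upTo⁻)
open import Relation.Nullary using (¬_; yes; no; contradiction)
open import Relation.Nullary.Decidable using (⌊_⌋; isYes≗does; dec-true; dec-false)
open import Relation.Binary.Bundles using (StrictTotalOrder)
open import Relation.Binary.Definitions using (Cotransitive; Tri; tri<; tri≈; tri>)
open import Relation.Binary.PropositionalEquality hiding ([_])
open ≡-Reasoning
open import Defs

data Opens (P : ℕ → Set) : Event → Set where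
  opens  : ∀ {j} → P j → Opens P open⟨ j ⟩
  closes : Opens P close

Opens-map : ∀ {P Q : ℕ → Set} → (∀ {j} → P j → Q j) → ∀ {e} → Opens P e → Opens Q e
Opens-map P⇒Q (opens p) = opens (P⇒Q p)
Opens-map P⇒Q closes    = closes

posOpen-self : ∀ y es → posOpen y (open⟨ y ⟩ ∷ es) ≡ 0
posOpen-self y es with y ≟ y
... | yes _  = refl
... | no y≢y = contradiction refl y≢y

posOpen-other : ∀ {y j} es → y ≢ j → posOpen y (open⟨ j ⟩ ∷ es) ≡ suc (posOpen y es)
posOpen-other {y} {j} es y≢j with y ≟ j
... | yes y≡j = contradiction y≡j y≢j
... | no _    = refl

posOpen-++ : ∀ {y} xs zs → All (Opens (_< y)) xs → posOpen y (xs ++ zs) ≡ length xs + posOpen y zs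
posOpen-++ []               zs []            = refl
posOpen-++ (open⟨ j ⟩ ∷ xs) zs (opens j<y ∷ below) =
  trans (posOpen-other (xs ++ zs) (>⇒≢ j<y)) (cong suc (posOpen-++ xs zs below))
posOpen-++ (close ∷ xs)     zs (_ ∷ below)   = cong suc (posOpen-++ xs zs below)

posOpen-suc-gap : ∀ {i} xs zs → All (Opens (_< i)) xs →
  posOpen (suc i) (xs ++ open⟨ i ⟩ ∷ zs) ≡ posOpen i (xs ++ open⟨ i ⟩ ∷ zs) + suc (posOpen (suc i) zs)
posOpen-suc-gap {i} xs zs below = begin
  posOpen (suc i) (xs ++ open⟨ i ⟩ ∷ zs)
    ≡⟨ posOpen-++ xs _ (All.map (Opens-map m<n⇒m<1+n) below) ⟩
  length xs + posOpen (suc i) (open⟨ i ⟩ ∷ zs)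
    ≡⟨ cong (length xs +_) (posOpen-other zs 1+n≢n) ⟩
  length xs + suc (posOpen (suc i) zs)
    ≡⟨ cong (_+ suc (posOpen (suc i) zs)) (sym (begin
         posOpen i (xs ++ open⟨ i ⟩ ∷ zs)     ≡⟨ posOpen-++ xs _ below ⟩
         length xs + posOpen i (open⟨ i ⟩ ∷ zs) ≡⟨ cong (length xs +_) (posOpen-self i zs) ⟩
         length xs + 0                        ≡⟨ +-identityʳ (length xs) ⟩
         length xs                            ∎)) ⟩
  posOpen i (xs ++ open⟨ i ⟩ ∷ zs) + suc (posOpen (suc i) zs) ∎

data Subtree (s : Tree) : Tree → Set where
  here  : Subtree s s
  there : ∀ {j ts t} → t ∈ ts → Subtree s t → Subtree s (node j ts)

Subtree-trans : ∀ {s t u} → Subtree s t → Subtree t u → Subtree s u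
Subtree-trans s⊑t here          = s⊑t
Subtree-trans s⊑t (there t∈ r) = there t∈ (Subtree-trans s⊑t r)

Subtree⇒Internal : ∀ {i t ts u} → Subtree (node i (t ∷ ts)) u → Internal i u
Subtree⇒Internal here          = here _ _
Subtree⇒Internal (there t∈ r) = there t∈ (Subtree⇒Internal r)

eventsF-++ : ∀ ts us → eventsF (ts ++ us) ≡ eventsF ts ++ eventsF us
eventsF-++ []       us = refl
eventsF-++ (t ∷ ts) us = trans (cong (events t ++_) (eventsF-++ ts us)) (sym (++-assoc (events t) _ _))

All-eventsF-map⁺ : ∀ {P : Event → Set} (g : ℕ → Tree) as →
  (∀ {a} → a ∈ as → All P (events (g a))) → All P (eventsF (map g as))
All-eventsF-map⁺ g []       _   = []
All-eventsF-map⁺ g (a ∷ as) all = ++⁺ (all (here refl)) (All-eventsF-map⁺ g as (all ∘ there))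

events-node-split : ∀ j (g : ℕ → Tree) as x bs →
  events (node j (map g (as ++ x ∷ bs))) ≡
  (open⟨ j ⟩ ∷ eventsF (map g as)) ++ events (g x) ++ eventsF (map g bs) ++ [ close ]
events-node-split j g as x bs = cong (open⟨ j ⟩ ∷_) (begin
  eventsF (map g (as ++ x ∷ bs)) ++ [ close ]
    ≡⟨ cong (λ ts → eventsF ts ++ [ close ]) (map-++ g as (x ∷ bs)) ⟩
  eventsF (map g as ++ map g (x ∷ bs)) ++ [ close ]
    ≡⟨ cong (_++ [ close ]) (eventsF-++ (map g as) _) ⟩
  (EA ++ EX ++ EB) ++ [ close ]
    ≡⟨ ++-assoc EA _ _ ⟩
  EA ++ (EX ++ EB) ++ [ close ]
    ≡⟨ cong (EA ++_) (++-assoc EX EB _) ⟩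
  EA ++ EX ++ EB ++ [ close ] ∎)
  where
  EA = eventsF (map g as)
  EX = events (g x)
  EB = eventsF (map g bs)

++-regroup : ∀ {A : Set} (xs ps es ss ys : List A) →
  xs ++ (ps ++ es ++ ss) ++ ys ≡ (xs ++ ps) ++ es ++ ss ++ ys
++-regroup xs ps es ss ys = begin
  xs ++ (ps ++ es ++ ss) ++ ys ≡⟨ cong (xs ++_) (++-assoc ps (es ++ ss) ys) ⟩
  xs ++ ps ++ (es ++ ss) ++ ys ≡⟨ cong (λ zs → xs ++ ps ++ zs) (++-assoc es ss ys) ⟩
  xs ++ ps ++ es ++ ss ++ ys   ≡⟨ ++-assoc xs ps _ ⟨
  (xs ++ ps) ++ es ++ ss ++ ys ∎

sorted-split : ∀ {x L} → AllPairs _<_ L → x ∈ L → ∃₂ λ as bs → L ≡ as ++ x ∷ bs × All (_< x) as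
sorted-split {L = y ∷ L} (_ ∷ _)        (here refl) = [] , L , refl , []
sorted-split {L = y ∷ L} (y< ∷ sorted) (there x∈) with sorted-split sorted x∈
... | as , bs , L≡ , as<x = y ∷ as , bs , cong (y ∷_) L≡ , All.lookup y< x∈ ∷ as<x

module ParentTree {c ℓ₁ ℓ₂ : Level} (O : StrictTotalOrder c ℓ₁ ℓ₂) {n : ℕ}
  (A : Fin n → StrictTotalOrder.Carrier O)
  (R : Cartesian.Ext O → Cartesian.Ext O → Bool) (e0 : Cartesian.Ext O)
  (R-cotransitive : Cotransitive (λ a b → R a b ≡ true)) where
  open Cartesian O using (Ext; val; search; parent; children; build)

  V : ℕ → Ext
  V = val A e0

  seek : ℕ → Ext → ℕ
  seek = search A R e0

  par : ℕ → ℕ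
  par = parent A R e0

  kids : ℕ → List ℕ
  kids = children A R e0

  grow : ℕ → ℕ → Tree
  grow = build A R e0

  T : Tree
  T = grow (suc n) 0

  links : ℕ → Bool
  links i = R (V i) (V (suc i))

  R-between : ∀ {a b} d → R a b ≡ true → R d b ≡ false → R a d ≡ true
  R-between d ab db with R-cotransitive ab d
  ... | inj₁ ad  = ad
  ... | inj₂ db′ = contradiction (trans (sym db′) db) λ ()

  seek-≤ : ∀ m v → seek m v ≤ m
  seek-≤ zero    v = z≤n
  seek-≤ (suc j) v with R (V (suc j)) v
  ... | true  = ≤-refl
  ... | false = m≤n⇒m≤1+n (seek-≤ j v)

  seek-found : ∀ m v → seek m v ≡ 0 ⊎ R (V (seek m v)) v ≡ true
  seek-found zero    v = inj₁ refl
  seek-found (suc j) v with R (V (suc j)) v in found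
  ... | true  = inj₂ found
  ... | false = seek-found j v

  seek-skips : ∀ m v {y} → seek m v < y → y ≤ m → R (V y) v ≡ false
  seek-skips zero    v s<y y≤m = contradiction (<-≤-trans s<y y≤m) λ ()
  seek-skips (suc j) v s<y y≤m with R (V (suc j)) v in skipped
  ... | true  = contradiction (<-≤-trans s<y y≤m) (<-irrefl refl)
  ... | false with m≤n⇒m<n∨m≡n y≤m
  ...   | inj₁ y<1+j = seek-skips j v s<y (≤-pred y<1+j)
  ...   | inj₂ refl  = skipped

  seek-maximal : ∀ m v {y} → y ≤ m → R (V y) v ≡ true → y ≤ seek m v
  seek-maximal m v {y} y≤m found with y ≤? seek m v
  ... | yes y≤s = y≤s
  ... | no  y≰s = contradiction (trans (sym found) (seek-skips m v (≰⇒> y≰s) y≤m)) λ ()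

  par-≤ : ∀ x → par x ≤ x
  par-≤ zero    = z≤n
  par-≤ (suc x) = m≤n⇒m≤1+n (seek-≤ x _)

  par-< : ∀ {x} → 1 ≤ x → par x < x
  par-< {suc x} _ = s≤s (seek-≤ x _)

  par-nested : ∀ {x y} → par x < y → y < x → par x ≤ par y
  par-nested {suc x} {suc y} px<y y<x with seek-found x (V (suc x))
  ... | inj₁ px≡0    = subst (_≤ par (suc y)) (sym px≡0) z≤n
  ... | inj₂ R-px-x = seek-maximal y _ (≤-pred px<y)
                        (R-between _ R-px-x (seek-skips x _ px<y (≤-pred y<x)))

  links⇒par : ∀ {i} → links i ≡ true → par (suc i) ≡ i
  links⇒par {i} linked = ≤-antisym (seek-≤ i _) (seek-maximal i _ ≤-refl linked)

  unlinked⇒par≢ : ∀ {i} → 1 ≤ i → links i ≡ false → par (suc i) ≢ i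
  unlinked⇒par≢ {i} 1≤i unlinked p≡i with seek-found i (V (suc i))
  ... | inj₁ p≡0     = contradiction (trans (sym p≡i) p≡0) (>⇒≢ 1≤i)
  ... | inj₂ R-p-1+i = contradiction
          (trans (sym (subst (λ j → R (V j) (V (suc i)) ≡ true) p≡i R-p-1+i)) unlinked) λ ()

  unlinked⇒childless : ∀ {i} → 1 ≤ i → links i ≡ false → ∀ x → par x ≢ i
  unlinked⇒childless {i} 1≤i unlinked zero p≡i = contradiction p≡i (<⇒≢ 1≤i)
  unlinked⇒childless {i} 1≤i unlinked (suc x) p≡i with <-cmp x i
  ... | tri< x<i _ _  = contradiction p≡i (<⇒≢ (≤-<-trans (seek-≤ x _) x<i))
  ... | tri≈ _ refl _ = unlinked⇒par≢ 1≤i unlinked p≡i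
  ... | tri> _ _ i<x  = unlinked⇒par≢ 1≤i unlinked (≤-antisym (seek-≤ i _)
          (subst (_≤ par (suc i)) p≡i (par-nested (subst (_< suc i) (sym p≡i) ≤-refl) (s≤s i<x))))

  ∈-kids⁻ : ∀ {j x} → x ∈ kids j → par x ≡ j × 1 ≤ x × x ≤ n
  ∈-kids⁻ {j} x∈ with ∈-filter⁻ (λ y → par y ≟ j) {xs = map suc (upTo n)} x∈
  ... | x∈range , p≡j with ∈-map⁻ suc x∈range
  ...   | y , y∈ , refl = p≡j , s≤s z≤n , ∈-upTo⁻ y∈

  ∈-kids⁺ : ∀ {j x} → par x ≡ j → 1 ≤ x → x ≤ n → x ∈ kids j
  ∈-kids⁺ {j} {suc x} p≡j _ x≤n = ∈-filter⁺ (λ y → par y ≟ j) (∈-map⁺ suc (∈-upTo⁺ x≤n)) p≡j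

  kids-sorted : ∀ j → AllPairs _<_ (kids j)
  kids-sorted j = AllPairs.filter⁺ (λ y → par y ≟ j)
    (AllPairs.map⁺ (AllPairs.applyUpTo⁺₁ (λ y → y) n (λ i<j _ → s≤s i<j)))

  data Descendant (a : ℕ) : ℕ → Set where
    self  : Descendant a a
    child : ∀ {d} → Descendant a (par d) → Descendant a d

  Descendant⇒≤ : ∀ {a d} → Descendant a d → a ≤ d
  Descendant⇒≤ self              = ≤-refl
  Descendant⇒≤ (child {d} a≼pd) = ≤-trans (Descendant⇒≤ a≼pd) (par-≤ d)

  Descendant-of-kid : ∀ {a c d} → par c ≡ a → Descendant c d → Descendant a d
  Descendant-of-kid refl self           = child self
  Descendant-of-kid pc   (child c≼pd) = child (Descendant-of-kid pc c≼pd)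

  sibling-≰-par : ∀ {c c′} → 1 ≤ c → par c ≡ par c′ → ¬ c ≤ par c′
  sibling-≰-par 1≤c siblings = subst (λ p → ¬ _ ≤ p) siblings (<⇒≱ (par-< 1≤c))

  Descendant-<-later-sibling : ∀ {c c′ d} → 1 ≤ c → par c ≡ par c′ → c < c′ → Descendant c d → d < c′
  Descendant-<-later-sibling 1≤c siblings c<c′ self = c<c′
  Descendant-<-later-sibling {c′ = c′} 1≤c siblings c<c′ (child {d} c≼pd) with <-cmp d c′
  ... | tri< d<c′ _ _ = d<c′
  ... | tri≈ _ refl _ = contradiction (Descendant⇒≤ c≼pd) (sibling-≰-par {c′ = c′} 1≤c siblings)
  ... | tri> _ _ c′<d = contradiction
          (≤-trans (Descendant⇒≤ c≼pd)
                   (par-nested (Descendant-<-later-sibling 1≤c siblings c<c′ c≼pd) c′<d))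
          (sibling-≰-par {c′ = c′} 1≤c siblings)

  events-grow-Descendant : ∀ k a → All (Opens (Descendant a)) (events (grow k a))
  events-grow-Descendant zero    a = opens self ∷ closes ∷ []
  events-grow-Descendant (suc k) a = opens self ∷
    ++⁺ (All-eventsF-map⁺ (grow k) (kids a) λ c∈ →
           All.map (Opens-map (Descendant-of-kid (proj₁ (∈-kids⁻ c∈)))) (events-grow-Descendant k _))
        (closes ∷ [])

  events-grow-below-later-sibling : ∀ k {c x} → 1 ≤ c → par c ≡ par x → c < x →
    All (Opens (_< x)) (events (grow k c))
  events-grow-below-later-sibling k 1≤c siblings c<x =
    All.map (Opens-map (Descendant-<-later-sibling 1≤c siblings c<x)) (events-grow-Descendant k _)

  -- Fuel drops by one per level while labels grow, so n ≤ fuel + x keeps every proper ancestor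
  -- of a node x ≤ n built with positive fuel, i.e. with its children listed.
  record Located (x : ℕ) : Set where
    constructor located
    field
      fuel         : ℕ
      before after : List Event
      fuel-enough  : n ≤ fuel + x
      events-T     : events T ≡ before ++ events (grow (suc fuel) x) ++ after
      before-below : All (Opens (_< x)) before
      subtree      : Subtree (grow (suc fuel) x) T

  root-located : Located 0
  root-located = located n [] [] (≤-reflexive (sym (+-identityʳ n))) (sym (++-identityʳ _)) [] here

  locate-kid : ∀ {x} → 1 ≤ x → x ≤ n → Located (par x) → Located x
  locate-kid 1≤x x≤n (located zero _ _ enough _ _ _) = contradiction enough (<⇒≱ (<-≤-trans (par-< 1≤x) x≤n))
  locate-kid {x} 1≤x x≤n (located (suc k) xs ys enough split below sub)
    with sorted-split (kids-sorted (par x)) (∈-kids⁺ refl 1≤x x≤n)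
  ... | as , bs , kids≡ , as<x =
    located k (xs ++ open⟨ par x ⟩ ∷ EA) ((EB ++ [ close ]) ++ ys) enough′ split′ below′ sub′
    where
    EA = eventsF (map (grow (suc k)) as)
    EB = eventsF (map (grow (suc k)) bs)
    px<x = par-< 1≤x
    enough′ : n ≤ k + x
    enough′ = ≤-trans enough (≤-trans (≤-reflexive (sym (+-suc k (par x)))) (+-monoʳ-≤ k px<x))
    split′ : events T ≡ (xs ++ open⟨ par x ⟩ ∷ EA) ++ events (grow (suc k) x) ++ (EB ++ [ close ]) ++ ys
    split′ = begin
      events T
        ≡⟨ split ⟩
      xs ++ events (node (par x) (map (grow (suc k)) (kids (par x)))) ++ ys
        ≡⟨ cong (λ L → xs ++ events (node (par x) (map (grow (suc k)) L)) ++ ys) kids≡ ⟩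
      xs ++ events (node (par x) (map (grow (suc k)) (as ++ x ∷ bs))) ++ ys
        ≡⟨ cong (λ es → xs ++ es ++ ys) (events-node-split (par x) (grow (suc k)) as x bs) ⟩
      xs ++ ((open⟨ par x ⟩ ∷ EA) ++ events (grow (suc k) x) ++ EB ++ [ close ]) ++ ys
        ≡⟨ ++-regroup xs (open⟨ par x ⟩ ∷ EA) (events (grow (suc k) x)) (EB ++ [ close ]) ys ⟩
      (xs ++ open⟨ par x ⟩ ∷ EA) ++ events (grow (suc k) x) ++ (EB ++ [ close ]) ++ ys ∎
    below′ : All (Opens (_< x)) (xs ++ open⟨ par x ⟩ ∷ EA)
    below′ = ++⁺ (All.map (Opens-map (λ j<px → <-trans j<px px<x)) below)
                 (opens px<x ∷ All-eventsF-map⁺ (grow (suc k)) as λ a∈ →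
                    let (pa≡px , 1≤a , _) = ∈-kids⁻ (subst (_ ∈_) (sym kids≡) (∈-++⁺ˡ a∈)) in
                    events-grow-below-later-sibling (suc k) 1≤a pa≡px (All.lookup as<x a∈))
    sub′ : Subtree (grow (suc k) x) T
    sub′ = Subtree-trans (there (∈-map⁺ (grow (suc k)) (∈-kids⁺ refl 1≤x x≤n)) here) sub

  locate : ∀ x → x ≤ n → Located x
  locate = <-rec (λ x → x ≤ n → Located x) step
    where
    step : ∀ x → (∀ {y} → y < x → y ≤ n → Located y) → x ≤ n → Located x
    step zero    _          _   = root-located
    step (suc x) located-<x x≤n =
      locate-kid (s≤s z≤n) x≤n (located-<x (par-< (s≤s z≤n)) (≤-trans (par-≤ (suc x)) x≤n))

  f-suc : ∀ {i} (L : Located i) → let open Located L in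
    f (suc i) T ≡ f i T + suc (posOpen (suc i) ((eventsF (map (grow fuel) (kids i)) ++ [ close ]) ++ after))
  f-suc {i} (located k xs ys _ split below _) = begin
    posOpen (suc i) (events T)               ≡⟨ cong (posOpen (suc i)) split ⟩
    posOpen (suc i) (xs ++ open⟨ i ⟩ ∷ zs)    ≡⟨ posOpen-suc-gap xs zs below ⟩
    posOpen i (xs ++ open⟨ i ⟩ ∷ zs) + suc (posOpen (suc i) zs)
                                             ≡⟨ cong (λ es → posOpen i es + _) split ⟨
    f i T + suc (posOpen (suc i) zs)          ∎
    where zs = (eventsF (map (grow k) (kids i)) ++ [ close ]) ++ ys

  posOpen-first-grown : ∀ k j ts ys → posOpen j ((eventsF (grow k j ∷ ts) ++ [ close ]) ++ ys) ≡ 0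
  posOpen-first-grown zero    j ts ys = posOpen-self j _
  posOpen-first-grown (suc k) j ts ys = posOpen-self j _

  first-kid : ∀ {i} → i < n → links i ≡ true → ∃ λ cs → kids i ≡ suc i ∷ cs
  first-kid {i} i<n linked with kids i in kids≡ | ∈-kids⁺ {i} {suc i} (links⇒par linked) (s≤s z≤n) i<n
  ... | c ∷ cs | here refl = cs , refl
  ... | c ∷ cs | there 1+i∈ with subst (AllPairs _<_) kids≡ (kids-sorted i)
  ...   | c< ∷ _ = contradiction (All.lookup c< 1+i∈) (≤⇒≯ (subst (_< c) pc≡i (par-< 1≤c)))
    where
    pc≡i = proj₁ (∈-kids⁻ (subst (c ∈_) (sym kids≡) (here refl)))
    1≤c = proj₁ (proj₂ (∈-kids⁻ (subst (c ∈_) (sym kids≡) (here refl))))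

  linked-step : ∀ {i} → i < n → links i ≡ true → f (suc i) T ≡ f i T + 1 × Internal i T
  linked-step {i} i<n linked with locate i (<⇒≤ i<n) | first-kid i<n linked
  ... | L@(located k _ ys _ _ _ sub) | cs , kids≡ =
    (begin
      f (suc i) T
        ≡⟨ f-suc L ⟩
      f i T + suc (posOpen (suc i) ((eventsF (map (grow k) (kids i)) ++ [ close ]) ++ ys))
        ≡⟨ cong (λ L → f i T + suc (posOpen (suc i) ((eventsF (map (grow k) L) ++ [ close ]) ++ ys))) kids≡ ⟩
      f i T + suc (posOpen (suc i) ((eventsF (map (grow k) (suc i ∷ cs)) ++ [ close ]) ++ ys))
        ≡⟨ cong (λ m → f i T + suc m) (posOpen-first-grown k (suc i) (map (grow k) cs) ys) ⟩
      f i T + 1 ∎)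
    , Subtree⇒Internal (subst (λ L → Subtree (node i (map (grow k) L)) T) kids≡ sub)

  unlinked-kids : ∀ {i} → 1 ≤ i → links i ≡ false → kids i ≡ []
  unlinked-kids {i} 1≤i unlinked =
    filter-none (λ y → par y ≟ i) (All.universal (unlinked⇒childless 1≤i unlinked) (map suc (upTo n)))

  unlinked-step : ∀ {i} → 1 ≤ i → i ≤ n → links i ≡ false → ∃ λ k → 1 < k × f (suc i) T ≡ f i T + k
  unlinked-step {i} 1≤i i≤n unlinked with locate i i≤n
  ... | L@(located k _ ys _ _ _ _) = 2 + posOpen (suc i) ys , s≤s (s≤s z≤n) ,
    trans (f-suc L)
      (cong (λ L → f i T + suc (posOpen (suc i) ((eventsF (map (grow k) L) ++ [ close ]) ++ ys)))
            (unlinked-kids 1≤i unlinked))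

  Internal-grow⇒kid : ∀ {i} k j → Internal i (grow k j) → ∃ λ c → c ∈ kids i
  Internal-grow⇒kid zero j (there () _)
  Internal-grow⇒kid (suc k) j internal with kids j in kids≡
  ... | [] with internal
  ...   | there () _
  Internal-grow⇒kid (suc k) j internal | c ∷ cs with internal
  ...   | here _ _ = c , subst (c ∈_) (sym kids≡) (here refl)
  ...   | there t∈ internal′ with ∈-map⁻ (grow k) t∈
  ...     | d , _ , refl = Internal-grow⇒kid k d internal′

  Internal⇒links : ∀ {i} → 1 ≤ i → Internal i T → links i ≡ true
  Internal⇒links 1≤i internal = ¬-not λ unlinked →
    let (c , c∈) = Internal-grow⇒kid (suc n) 0 internal in
    contradiction (subst (c ∈_) (unlinked-kids 1≤i unlinked) c∈) λ ()

module ExtendedOrder {c ℓ₁ ℓ₂ : Level} (O : StrictTotalOrder c ℓ₁ ℓ₂) where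
  open StrictTotalOrder O renaming (Carrier to C; _<_ to _⊏_; _<?_ to _⊏?_; trans to ⊏-trans)
  open Cartesian O using (Ext; -∞; +∞; fin; _<ᴱ?_; val)

  ⌊⊏?⌋-true : ∀ {x y} → x ⊏ y → ⌊ x ⊏? y ⌋ ≡ true
  ⌊⊏?⌋-true {x} {y} x⊏y = trans (isYes≗does (x ⊏? y)) (dec-true (x ⊏? y) x⊏y)

  ⌊⊏?⌋-false : ∀ {x y} → ¬ x ⊏ y → ⌊ x ⊏? y ⌋ ≡ false
  ⌊⊏?⌋-false {x} {y} x⋢y = trans (isYes≗does (x ⊏? y)) (dec-false (x ⊏? y) x⋢y)

  ⊏-cotransitive : Cotransitive _⊏_
  ⊏-cotransitive {y = y} x⊏y z with compare z y
  ... | tri< z⊏y _ _ = inj₂ z⊏y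
  ... | tri≈ _ z≈y _ = inj₁ (<-respʳ-≈ (Eq.sym z≈y) x⊏y)
  ... | tri> _ _ y⊏z = inj₁ (⊏-trans x⊏y y⊏z)

  <ᴱ?-cotransitive : Cotransitive (λ a b → (a <ᴱ? b) ≡ true)
  <ᴱ?-cotransitive { -∞ }  {_}     a<b -∞      = inj₂ a<b
  <ᴱ?-cotransitive { -∞ }  {_}     _   +∞      = inj₁ refl
  <ᴱ?-cotransitive { -∞ }  {_}     _   (fin _) = inj₁ refl
  <ᴱ?-cotransitive {fin _} {+∞}    _   -∞      = inj₂ refl
  <ᴱ?-cotransitive {fin _} {+∞}    _   +∞      = inj₁ refl
  <ᴱ?-cotransitive {fin _} {+∞}    _   (fin _) = inj₂ refl
  <ᴱ?-cotransitive {fin _} {fin _} _   -∞      = inj₂ refl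
  <ᴱ?-cotransitive {fin _} {fin _} _   +∞      = inj₁ refl
  <ᴱ?-cotransitive {fin x} {fin y} x⊏y (fin z) with x ⊏? y
  ... | yes x⊏y = Sum.map ⌊⊏?⌋-true ⌊⊏?⌋-true (⊏-cotransitive x⊏y z)

  ⌊⊏?⌋-flip : ∀ {x y} → ¬ x ≈ y → ⌊ y ⊏? x ⌋ ≡ not ⌊ x ⊏? y ⌋
  ⌊⊏?⌋-flip {x} {y} x≉y = by-trichotomy (compare x y)
    where
    by-trichotomy : Tri (x ⊏ y) (x ≈ y) (y ⊏ x) → ⌊ y ⊏? x ⌋ ≡ not ⌊ x ⊏? y ⌋
    by-trichotomy (tri< x⊏y _ y⋢x) = trans (⌊⊏?⌋-false y⋢x) (cong not (sym (⌊⊏?⌋-true x⊏y)))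
    by-trichotomy (tri≈ _ x≈y _)   = contradiction x≈y x≉y
    by-trichotomy (tri> x⋢y _ y⊏x) = trans (⌊⊏?⌋-true y⊏x) (cong not (sym (⌊⊏?⌋-false x⋢y)))

  module _ {n : ℕ} (A : Fin n → C) where

    val-fin : ∀ e0 {j} (q : suc j ≤ n) → val A e0 (suc j) ≡ fin (A (fromℕ< q))
    val-fin e0 {j} q with suc j ≤? n
    ... | yes q′ = cong (λ r → fin (A (fromℕ< r))) (≤-irrelevant q′ q)
    ... | no ¬q  = contradiction q ¬q

    links-flip : (∀ t u → toℕ u ≡ suc (toℕ t) → ¬ A t ≈ A u) → ∀ {i} → 1 ≤ i → i < n →
      (val A +∞ (suc i) <ᴱ? val A +∞ i) ≡ not (val A -∞ i <ᴱ? val A -∞ (suc i))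
    links-flip adjacent-distinct {suc i} _ 1+i<n = begin
      val A +∞ (suc (suc i)) <ᴱ? val A +∞ (suc i) ≡⟨ cong₂ _<ᴱ?_ (val-fin +∞ 1+i<n) (val-fin +∞ i<n) ⟩
      ⌊ A v ⊏? A u ⌋                              ≡⟨ ⌊⊏?⌋-flip (adjacent-distinct u v next) ⟩
      not ⌊ A u ⊏? A v ⌋                          ≡⟨ cong not (cong₂ _<ᴱ?_ (val-fin -∞ i<n) (val-fin -∞ 1+i<n)) ⟨
      not (val A -∞ (suc i) <ᴱ? val A -∞ (suc (suc i))) ∎
      where
      i<n = <⇒≤ 1+i<n
      u = fromℕ< i<n
      v = fromℕ< 1+i<n
      next : toℕ v ≡ suc (toℕ u)
      next = trans (toℕ-fromℕ< 1+i<n) (cong suc (sym (toℕ-fromℕ< i<n)))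

lemma6 : ∀ {c ℓ₁ ℓ₂ : Level} (O : StrictTotalOrder c ℓ₁ ℓ₂) (n : ℕ)
    (A : Fin n → StrictTotalOrder.Carrier O) →
    (∀ (t u : Fin n) → toℕ u ≡ suc (toℕ t) → ¬ StrictTotalOrder._≈_ O (A t) (A u)) →
    ∀ (i : ℕ) → 1 ≤ i → i < n →
    (Internal i (Cartesian.cMin O A) →
        (f (suc i) (Cartesian.cMin O A) ≡ f i (Cartesian.cMin O A) + 1)
      × ∃ (λ k → 1 < k × f (suc i) (Cartesian.cMax O A) ≡ f i (Cartesian.cMax O A) + k))
    × (¬ Internal i (Cartesian.cMin O A) →
        (f (suc i) (Cartesian.cMax O A) ≡ f i (Cartesian.cMax O A) + 1)
      × ∃ (λ k → 1 < k × f (suc i) (Cartesian.cMin O A) ≡ f i (Cartesian.cMin O A) + k))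
lemma6 O n A adjacent-distinct i 1≤i i<n =
    (λ internal →
      let min-linked = Min.Internal⇒links 1≤i internal in
      proj₁ (Min.linked-step i<n min-linked) ,
      Max.unlinked-step 1≤i (<⇒≤ i<n) (trans flipped (cong not min-linked)))
  , (λ not-internal →
      let min-unlinked = ¬-not (not-internal ∘ proj₂ ∘ Min.linked-step i<n) in
      proj₁ (Max.linked-step i<n (trans flipped (cong not min-unlinked))) ,
      Min.unlinked-step 1≤i (<⇒≤ i<n) min-unlinked)
  where
  open Cartesian O using (_<ᴱ?_; -∞; +∞)
  open ExtendedOrder O using (<ᴱ?-cotransitive; links-flip)
  module Min = ParentTree O A (λ a b → a <ᴱ? b) -∞ (λ {a} {b} → <ᴱ?-cotransitive {a} {b})
  module Max = ParentTree O A (λ a b → b <ᴱ? a) +∞ (λ {a} {b} b<a d → swap (<ᴱ?-cotransitive {b} {a} b<a d))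
  flipped : Max.links i ≡ not (Min.links i)
  flipped = links-flip A adjacent-distinct 1≤i i<n
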